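{- Let $\mathcal{O}$ be a class of admissible orderings of structures in $\mathcal{D}_1$ (with respect to a fixed linear order $\lhd$ as below). Let $(A,\prec_A)\in\mathcal{O}$, let $a\in A$ and let $b\in a^\circ$. Then $b\prec_A a$.
   Context: An orientation of a graph is a $2$-orientation if each vertex has out-degree $\le 2$, acyclic if there are no directed cycles. $\mathcal{D}_1$ is the class of finite acyclic $2$-oriented graphs. For an oriented graph $A$, $B\subseteq A$ is successor-closed if all out-neighbours of vertices of $B$ lie in $B$; $\mathrm{scl}_A(X)$ is the smallest successor-closed subset containing $X$. For $a\in A$, $a^\circ=\mathrm{scl}_A(a)\setminus\{a\}$. A closure-extension is some $A\in\mathcal{D}_1$ with $A=\mathrm{scl}_A(a)$ for some (necessarily unique) $a$. An ordered structure $A^\prec$ is $A\in\mathcal{D}_1$ with a linear order. Fix a linear order $\lhd$ on the isomorphism types of ordered closure-extensions such that $|A|<|B|$ implies $A^\prec\lhd B^\prec$. A class $\mathcal{O}$ of ordered structures $(A,\prec_A)$, $A\in\mathcal{D}_1$, is a class of admissible orderings if: (1) every $A\in\mathcal{D}_1$ has an expansion in $\mathcal{O}$; (2) $\mathcal{O}$ is closed under successor-closed substructures (with the induced order); (3) for $(A,\prec_A)\in\mathcal{O}$ and $u,v\in A$, if either $\mathrm{scl}_A(u)^\prec\lhd\mathrm{scl}_A(v)^\prec$, or $\mathrm{scl}_A(u)^\prec\cong\mathrm{scl}_A(v)^\prec$ and $u^\circ$ is lexicographically before $v^\circ$ with respect to $\prec_A$, then $u\prec_A v$ (here $\mathrm{scl}_A(u)^\prec$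 carries the order induced by $\prec_A$); (4) for each $B\in\mathcal{D}_1$, if $A_1,\dots,A_n$ are successor-closed in $B$ and $\prec'$ is a linear order on $\bigcup_i A_i$ satisfying (3) such that each $(A_i,\prec'|_{A_i})\in\mathcal{O}$, then there is $\prec_B$ extending $\prec'$ with $(B,\prec_B)\in\mathcal{O}$. -}

module Defs where

open import Data.Nat using (ℕ; _≤_; _<_)
open import Data.Fin using (Fin)
open import Data.Bool using (Bool; T)
open import Data.List using (List; length; filterᵇ; allFin)
open import Data.List.Membership.Propositional using (_∈_)
open import Data.List.Relation.Unary.Linked using (Linked)
open import Data.List.Relation.Binary.Lex.Strict using (Lex-<)
open import Data.Product using (Σ; _×_; _,_; proj₁; proj₂)
open import Data.Sum using (_⊎_)
open import Data.Unit using (⊤)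
open import Relation.Nullary using (¬_)
open import Relation.Binary using (Rel; IsStrictTotalOrder)
open import Relation.Binary.PropositionalEquality using (_≡_)
open import Relation.Binary.Construct.Closure.Transitive using (TransClosure)
open import Relation.Binary.Construct.Closure.ReflexiveTransitive using (Star)
open import Function.Bundles using (_⇔_)

-- Finite acyclic 2-oriented graphs (the class 𝒟₁), on vertex set Fin n.
-- E u v = true  means there is an arc u → v.

Subset : ℕ → Set₁
Subset n = Fin n → Set

record D1 : Set where
  field
    n       : ℕ
    E       : Fin n → Fin n → Bool
    outdeg  : ∀ u → length (filterᵇ (E u) (allFin n)) ≤ 2
    -- acyclic: no directed cycle (this also excludes loops and 2-cycles,
    -- so the arcs form an orientation of a simple graph)
    acyclic : ∀ u → ¬ TransClosure (λ x y → T (E x y)) u u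

open D1 public

Arc : (G : D1) → Rel (Fin (n G)) _
Arc G x y = T (E G x y)

SuccClosed : (G : D1) → Subset (n G) → Set
SuccClosed G S = ∀ u v → S u → Arc G u v → S v

-- scl_G(a): the smallest successor-closed set containing a, i.e. the set
-- of vertices reachable from a by a directed path (of length ≥ 0).
scl : (G : D1) → Fin (n G) → Subset (n G)
scl G a x = Star (Arc G) a x

circ : (G : D1) → Fin (n G) → Subset (n G)
circ G a x = scl G a x × ¬ (x ≡ a)

record Order (G : D1) : Set₁ where
  field
    _≺_   : Rel (Fin (n G)) _
    isSTO : IsStrictTotalOrder _≡_ _≺_

open Order public

OStr : Set₁
OStr = Σ D1 Order

osize : OStr → ℕ
osize C = n (proj₁ C)

oArc : (C : OStr) → Rel (Fin (osize C)) _
oArc C = Arc (proj₁ C)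

oLt : (C : OStr) → Rel (Fin (osize C)) _
oLt C = _≺_ (proj₂ C)

record _≅_ (C D : OStr) : Set where
  field
    to      : Fin (osize C) → Fin (osize D)
    from    : Fin (osize D) → Fin (osize C)
    to-from : ∀ y → to (from y) ≡ y
    from-to : ∀ x → from (to x) ≡ x
    arc     : ∀ x y → E (proj₁ C) x y ≡ E (proj₁ D) (to x) (to y)
    ord     : ∀ x y → (oLt C x y ⇔ oLt D (to x) (to y))

IsCE : OStr → Set
IsCE C = Σ (Fin (osize C)) λ a → ∀ x → scl (proj₁ C) a x

-- The fixed linear order ⊲ on isomorphism types of ordered
-- closure-extensions, with |A| < |B| ⇒ A ⊲ B.
record TypeOrder : Set₂ where
  field
    _⊲_    : OStr → OStr → Set
    resp   : ∀ {A A′ B B′} → IsCE A → IsCE A′ → IsCE B → IsCE B′ →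
             A ≅ A′ → B ≅ B′ → A ⊲ B → A′ ⊲ B′
    irrefl : ∀ {A} → IsCE A → ¬ (A ⊲ A)
    trans  : ∀ {A B C} → IsCE A → IsCE B → IsCE C → A ⊲ B → B ⊲ C → A ⊲ C
    total  : ∀ {A B} → IsCE A → IsCE B → (A ⊲ B) ⊎ (A ≅ B) ⊎ (B ⊲ A)
    size   : ∀ {A B} → IsCE A → IsCE B → osize A < osize B → A ⊲ B

-- C is (an isomorphic copy of) the ordered substructure of G induced on
-- S, with the order induced by R: an embedding f with image exactly S,
-- preserving and reflecting arcs and order.
record Induced (C : OStr) (G : D1) (R : Rel (Fin (n G)) _) (S : Subset (n G)) : Set where
  field
    f     : Fin (osize C) → Fin (n G)
    inj   : ∀ i j → f i ≡ f j → i ≡ j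
    image : ∀ x → (S x ⇔ Σ (Fin (osize C)) λ i → f i ≡ x)
    arc   : ∀ i j → E (proj₁ C) i j ≡ E G (f i) (f j)
    ord   : ∀ i j → (oLt C i j ⇔ R (f i) (f j))

Enumerates : {m : ℕ} → Rel (Fin m) _ → Subset m → List (Fin m) → Set
Enumerates R S xs = Linked R xs × (∀ x → (x ∈ xs ⇔ S x))

LexBefore : {m : ℕ} → Rel (Fin m) _ → Subset m → Subset m → Set
LexBefore R S T = ∀ xs ys → Enumerates R S xs → Enumerates R T ys → Lex-< _≡_ R xs ys

StrictTotalOn : {m : ℕ} → Rel (Fin m) _ → Subset m → Set
StrictTotalOn R U =
  (∀ x → U x → ¬ R x x) ×
  (∀ x y z → U x → U y → U z → R x y → R y z → R x z) ×
  (∀ x y → U x → U y → (R x y ⊎ x ≡ y ⊎ R y x))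

module _ (Ω : TypeOrder) where
  open TypeOrder Ω

  Cond3 : (G : D1) → Rel (Fin (n G)) _ → Subset (n G) → Set₁
  Cond3 G R U = ∀ u v → U u → U v →
    ( (Σ OStr λ C → Σ OStr λ D →
         Induced C G R (scl G u) × Induced D G R (scl G v) × (C ⊲ D))
    ⊎ ((Σ OStr λ C → Σ OStr λ D →
         Induced C G R (scl G u) × Induced D G R (scl G v) × (C ≅ D))
       × LexBefore R (circ G u) (circ G v)) )
    → R u v

  record Admissible (𝒪 : OStr → Set) : Set₁ where
    field
      expand  : ∀ (G : D1) → Σ (Order G) λ o → 𝒪 (G , o)
      subst   : ∀ (G : D1) (o : Order G) → 𝒪 (G , o) →
                ∀ (S : Subset (n G)) → SuccClosed G S →
                ∀ (C : OStr) → Induced C G (_≺_ o) S → 𝒪 C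
      cond3   : ∀ (G : D1) (o : Order G) → 𝒪 (G , o) →
                Cond3 G (_≺_ o) (λ _ → ⊤)
      amalg   : ∀ (B : D1) (k : ℕ) (As : Fin k → Subset (n B)) →
                (∀ i → SuccClosed B (As i)) →
                ∀ (R : Rel (Fin (n B)) _) →
                StrictTotalOn R (λ x → Σ (Fin k) λ i → As i x) →
                Cond3 B R (λ x → Σ (Fin k) λ i → As i x) →
                (∀ i → Σ OStr λ C → Induced C B R (As i) × 𝒪 C) →
                Σ (Order B) λ o →
                  (∀ x y → Σ (Fin k) (λ i → As i x) → Σ (Fin k) (λ i → As i y) →
                     R x y → _≺_ o x y)
                  × 𝒪 (B , o)

-- b ∈ a° means scl(b) ⊆ scl(a), and acyclicity makes the inclusion strict since a ∉ scl(b).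
-- Both sets are decidable (a finite fixpoint computation), so they carry induced ordered
-- closure-extensions, the one on scl(b) having fewer vertices. The fixed order ⊲ refines
-- size, so condition (3) of admissibility forces b ≺ a.
module Submission where

open import Defs
open import Data.Product using (_,_)
open import Data.Fin using (Fin)

open import Data.Bool using (Bool; T; true; false)
open import Data.Bool.Properties using (T?)
open import Data.Fin using (zero; suc)
open import Data.Fin.Properties using (any?; injective⇒≤)
open import Data.Fin.Subset as Bits using (⁅_⁆; _∪_; _⊂_; ∣_∣) renaming (_∈_ to _∈ᵇ_; _∉_ to _∉ᵇ_)
open import Data.Fin.Subset.Properties using (_∈?_; ∣p∣≤n; x∈⁅x⁆; x∈⁅y⁆⇒x≡y; x∈p∪q⁺; x∈p∪q⁻; p⊆p∪q; p⊂q⇒∣p∣<∣q∣)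
open import Data.List using (List; []; _∷_; length; filter; filterᵇ; allFin; lookup; map)
open import Data.List.Properties using (tabulate-lookup; map-tabulate)
open import Data.List.Membership.Propositional.Properties using (∈-allFin; ∈-lookup; ∈-filter⁺; ∈-filter⁻)
open import Data.List.Relation.Unary.All as All using ()
open import Data.List.Relation.Unary.AllPairs using (_∷_)
open import Data.List.Relation.Unary.Any using (index)
open import Data.List.Relation.Unary.Any.Properties using (lookup-index)
open import Data.List.Relation.Unary.Unique.Propositional using (Unique)
import Data.List.Relation.Unary.Unique.Propositional.Properties as Uniqueₚ
open import Data.List.Relation.Binary.Sublist.Propositional using (_⊆_)
import Data.List.Relation.Binary.Sublist.Propositional.Properties as Sublistₚ
open import Data.Nat using (ℕ; zero; suc; _≤_; _<_; _+_; s≤s; s≤s⁻¹)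
open import Data.Nat.Properties using (module ≤-Reasoning; ≤-<-trans; ≤⇒≯; m≤m+n; +-monoʳ-<)
open import Data.Product using (Σ; _×_; proj₁; proj₂)
open import Data.Sum using (inj₁; inj₂)
open import Data.Unit using (tt)
open import Function using (_∘_; id; _on_)
open import Function.Bundles using (_⇔_; mk⇔; Equivalence)
open import Function.Definitions using (Injective)
open import Level using (Level; 0ℓ)
open import Relation.Nullary using (¬_; Dec; yes; no; contradiction; _×-dec_; ¬?)
open import Relation.Nullary.Decidable using (map′)
open import Relation.Unary using (Decidable)
open import Relation.Binary using (Rel; Trichotomous; IsStrictTotalOrder; tri<; tri≈; tri>)
open import Relation.Binary.Structures.Biased using (isStrictTotalOrderᶜ)
open import Relation.Binary.PropositionalEquality using (_≡_; _≢_; refl; sym; trans; cong; subst; isEquivalence)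
open import Relation.Binary.Construct.Closure.Transitive using (TransClosure; [_]; _∷_)
open import Relation.Binary.Construct.Closure.ReflexiveTransitive using (Star; ε; _◅_; _◅◅_)

lookup-injective : {A : Set} {xs : List A} → Unique xs → Injective _≡_ _≡_ (lookup xs)
lookup-injective {xs = _ ∷ _} _ {zero} {zero} _ = refl
lookup-injective {xs = _ ∷ _} (x∉xs ∷ _) {zero} {suc j} eq = contradiction eq (All.lookup x∉xs (∈-lookup j))
lookup-injective {xs = _ ∷ _} (x∉xs ∷ _) {suc i} {zero} eq = contradiction (sym eq) (All.lookup x∉xs (∈-lookup i))
lookup-injective {xs = _ ∷ _} (_ ∷ u) {suc i} {suc j} eq = cong suc (lookup-injective u eq)

length-filterᵇ-map : {A B : Set} (p : B → Bool) (f : A → B) (xs : List A) →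
                     length (filterᵇ (p ∘ f) xs) ≡ length (filterᵇ p (map f xs))
length-filterᵇ-map p f [] = refl
length-filterᵇ-map p f (x ∷ xs) with p (f x)
... | true  = cong suc (length-filterᵇ-map p f xs)
... | false = length-filterᵇ-map p f xs

on-isStrictTotalOrder : {A B : Set} {ℓ : Level} {R : Rel B ℓ} (f : A → B) → Injective _≡_ _≡_ f →
                        IsStrictTotalOrder _≡_ R → IsStrictTotalOrder _≡_ (R on f)
on-isStrictTotalOrder {R = R} f f-inj sto = isStrictTotalOrderᶜ record
  { isEquivalence = isEquivalence
  ; trans         = IsStrictTotalOrder.trans sto
  ; compare       = compare
  }
  where
  compare : Trichotomous _≡_ (R on f)
  compare x y with IsStrictTotalOrder.compare sto (f x) (f y)
  ... | tri< lt x≢y gt = tri< lt (x≢y ∘ cong f) gt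
  ... | tri≈ lt x≡y gt = tri≈ lt (f-inj x≡y) gt
  ... | tri> lt x≢y gt = tri> lt (x≢y ∘ cong f) gt

module _ (G : D1) where

  scl-least : ∀ {S a x} → SuccClosed G S → S a → scl G a x → S x
  scl-least closed Sa ε       = Sa
  scl-least closed Sa (e ◅ p) = scl-least closed (closed _ _ Sa e) p

  scl-succClosed : ∀ a → SuccClosed G (scl G a)
  scl-succClosed a u v a⇝u e = a⇝u ◅◅ (e ◅ ε)

  private
    arc◅star : ∀ {x y z} → Arc G x y → Star (Arc G) y z → TransClosure (Arc G) x z
    arc◅star e ε       = [ e ]
    arc◅star e (e′ ◅ p) = e ∷ arc◅star e′ p

  circ⇒¬scl : ∀ {a b} → circ G a b → ¬ scl G b a
  circ⇒¬scl (ε , b≢a)     _   = b≢a refl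
  circ⇒¬scl (e ◅ a⇝b , _) b⇝a = acyclic G _ (arc◅star e (a⇝b ◅◅ b⇝a))

  private
    Escape : Bits.Subset (n G) → Set
    Escape p = Σ (Fin (n G)) λ x → Σ (Fin (n G)) λ y → x ∈ᵇ p × y ∉ᵇ p × Arc G x y

    escape? : ∀ p → Dec (Escape p)
    escape? p = any? λ x → any? λ y → x ∈? p ×-dec ¬? (y ∈? p) ×-dec T? (E G x y)

    ¬escape⇒succClosed : ∀ {p} → ¬ Escape p → SuccClosed G (_∈ᵇ p)
    ¬escape⇒succClosed {p} ¬esc u v u∈p e with v ∈? p
    ... | yes v∈p = v∈p
    ... | no  v∉p = contradiction (u , v , u∈p , v∉p , e) ¬esc

    SclSubset : Fin (n G) → Bits.Subset (n G) → Set
    SclSubset a p = SuccClosed G (_∈ᵇ p) × a ∈ᵇ p × (∀ {x} → x ∈ᵇ p → scl G a x)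

    -- Adds the head of an arc leaving p until p is successor-closed; |p| ≤ n bounds the rounds.
    grow : ∀ {a} fuel p → n G < fuel + ∣ p ∣ → a ∈ᵇ p → (∀ {x} → x ∈ᵇ p → scl G a x) →
           Σ (Bits.Subset (n G)) (SclSubset a)
    grow zero p bound _ _ = contradiction bound (≤⇒≯ (∣p∣≤n p))
    grow {a} (suc fuel) p bound a∈p sound with escape? p
    ... | no ¬esc = p , ¬escape⇒succClosed ¬esc , a∈p , sound
    ... | yes (x , y , x∈p , y∉p , e) = grow fuel (p ∪ ⁅ y ⁆) bound′ (p⊆p∪q ⁅ y ⁆ a∈p) sound′
      where
      p⊂p∪y : p ⊂ p ∪ ⁅ y ⁆
      p⊂p∪y = p⊆p∪q ⁅ y ⁆ , y , x∈p∪q⁺ (inj₂ (x∈⁅x⁆ y)) , y∉p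

      bound′ : n G < fuel + ∣ p ∪ ⁅ y ⁆ ∣
      bound′ = ≤-<-trans (s≤s⁻¹ bound) (+-monoʳ-< fuel (p⊂q⇒∣p∣<∣q∣ p⊂p∪y))

      sound′ : ∀ {z} → z ∈ᵇ p ∪ ⁅ y ⁆ → scl G a z
      sound′ {z} z∈ with x∈p∪q⁻ p ⁅ y ⁆ z∈
      ... | inj₁ z∈p = sound z∈p
      ... | inj₂ z∈y rewrite x∈⁅y⁆⇒x≡y y z∈y = scl-succClosed a x y (sound x∈p) e

    sclSubset : ∀ a → Σ (Bits.Subset (n G)) (SclSubset a)
    sclSubset a = grow (suc (n G)) ⁅ a ⁆ (s≤s (m≤m+n (n G) _)) (x∈⁅x⁆ a) ⁅a⁆⊆scl
      where
      ⁅a⁆⊆scl : ∀ {x} → x ∈ᵇ ⁅ a ⁆ → scl G a x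
      ⁅a⁆⊆scl x∈ rewrite x∈⁅y⁆⇒x≡y a x∈ = ε

  scl? : ∀ a → Decidable (scl G a)
  scl? a x = let p , closed , a∈p , sound = sclSubset a in
             map′ sound (scl-least closed a∈p) (x ∈? p)

injective-missing⇒< : {m k : ℕ} {f : Fin m → Fin k} → Injective _≡_ _≡_ f →
                      (y : Fin k) → (∀ i → f i ≢ y) → m < k
injective-missing⇒< {m} {k} {f} f-inj y missing = injective⇒≤ g-inj
  where
  g : Fin (suc m) → Fin k
  g zero    = y
  g (suc i) = f i

  g-inj : Injective _≡_ _≡_ g
  g-inj {zero}  {zero}  _  = refl
  g-inj {zero}  {suc j} eq = contradiction (sym eq) (missing j)
  g-inj {suc i} {zero}  eq = contradiction eq (missing i)
  g-inj {suc i} {suc j} eq = cong suc (f-inj eq)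

module InducedProperties {C : OStr} {G : D1} {R : Rel (Fin (n G)) 0ℓ} {S : Subset (n G)}
                         (ind : Induced C G R S) where
  open Induced ind public using (f; inj)

  preimage : ∀ {x} → S x → Σ (Fin (osize C)) λ i → f i ≡ x
  preimage = Equivalence.to (Induced.image ind _)

  f-mem : ∀ i → S (f i)
  f-mem i = Equivalence.from (Induced.image ind (f i)) (i , refl)

  lift : SuccClosed G S → ∀ {x y} → Star (Arc G) x y → ∀ i j → f i ≡ x → f j ≡ y → Star (oArc C) i j
  lift closed ε        i j refl fj≡fi = subst (Star (oArc C) i) (inj i j (sym fj≡fi)) ε
  lift closed (e ◅ p) i j refl fj≡y =
    let k , fk≡z = preimage (closed _ _ (f-mem i) e)
    in subst T (sym (Induced.arc ind i k)) (subst (Arc G (f i)) (sym fk≡z) e) ◅ lift closed p k j fk≡z fj≡y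

Induced-scl⇒IsCE : ∀ {C G} {R : Rel (Fin (n G)) 0ℓ} {a} → Induced C G R (scl G a) → IsCE C
Induced-scl⇒IsCE {G = G} {a = a} ind =
  let i₀ , fi₀≡a = preimage ε
  in i₀ , λ j → lift (scl-succClosed G a) (f-mem j) i₀ j fi₀≡a refl
  where open InducedProperties ind

Induced-size-< : ∀ {C D G} {R : Rel (Fin (n G)) 0ℓ} {S T y} →
                 Induced C G R S → Induced D G R T → (∀ {x} → S x → T x) → T y → ¬ S y →
                 osize C < osize D
Induced-size-< {C} {D} {S = S} indC indD S⊆T Ty ¬Sy =
  injective-missing⇒< h-inj (proj₁ (D.preimage Ty)) misses
  where
  module C = InducedProperties indC
  module D = InducedProperties indD

  h : Fin (osize C) → Fin (osize D)
  h i = proj₁ (D.preimage (S⊆T (C.f-mem i)))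

  fD∘h : ∀ i → D.f (h i) ≡ C.f i
  fD∘h i = proj₂ (D.preimage (S⊆T (C.f-mem i)))

  h-inj : Injective _≡_ _≡_ h
  h-inj {i} {j} eq = C.inj i j (trans (sym (fD∘h i)) (trans (cong D.f eq) (fD∘h j)))

  misses : ∀ i → h i ≢ proj₁ (D.preimage Ty)
  misses i eq = ¬Sy (subst S (trans (sym (fD∘h i)) (trans (cong D.f eq) (proj₂ (D.preimage Ty)))) (C.f-mem i))

module _ (G : D1) (o : Order G) {S : Subset (n G)} (S? : Decidable S) where
  private
    L : List (Fin (n G))
    L = filter S? (allFin (n G))

    f : Fin (length L) → Fin (n G)
    f = lookup L

    f-injective : Injective _≡_ _≡_ f
    f-injective = lookup-injective (Uniqueₚ.filter⁺ S? (Uniqueₚ.allFin⁺ (n G)))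

    map-f-allFin : map f (allFin (length L)) ≡ L
    map-f-allFin = trans (map-tabulate id f) (tabulate-lookup L)

    outdeg-sub : ∀ i → length (filterᵇ (E G (f i) ∘ f) (allFin (length L))) ≤ 2
    outdeg-sub i = begin
      length (filterᵇ (E G (f i) ∘ f) (allFin (length L)))   ≡⟨ length-filterᵇ-map (E G (f i)) f (allFin (length L)) ⟩
      length (filterᵇ (E G (f i)) (map f (allFin (length L)))) ≡⟨ cong (length ∘ filterᵇ (E G (f i))) map-f-allFin ⟩
      length (filterᵇ (E G (f i)) L)                         ≤⟨ Sublistₚ.length-mono-≤ L⊆allFin ⟩
      length (filterᵇ (E G (f i)) (allFin (n G)))            ≤⟨ outdeg G (f i) ⟩
      2                                                      ∎
      where
      open ≤-Reasoning
      L⊆allFin : filterᵇ (E G (f i)) L ⊆ filterᵇ (E G (f i)) (allFin (n G))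
      L⊆allFin = Sublistₚ.filter⁺ (T? ∘ E G (f i)) (T? ∘ E G (f i)) (λ { refl → id }) (Sublistₚ.filter-⊆ S? (allFin (n G)))

    embed : ∀ {i j} → TransClosure (λ i j → Arc G (f i) (f j)) i j → TransClosure (Arc G) (f i) (f j)
    embed [ e ]   = [ e ]
    embed (e ∷ c) = e ∷ embed c

    sub : D1
    sub = record
      { n       = length L
      ; E       = λ i j → E G (f i) (f j)
      ; outdeg  = outdeg-sub
      ; acyclic = λ i → acyclic G (f i) ∘ embed
      }

    sub-order : Order sub
    sub-order = record { _≺_ = _≺_ o on f ; isSTO = on-isStrictTotalOrder f f-injective (isSTO o) }

    image : ∀ x → S x ⇔ Σ (Fin (length L)) λ i → f i ≡ x
    image x = mk⇔ (λ Sx → let x∈L = ∈-filter⁺ S? (∈-allFin x) Sx in index x∈L , sym (lookup-index x∈L))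
                  (λ { (i , refl) → proj₂ (∈-filter⁻ S? {xs = allFin (n G)} (∈-lookup i)) })

  induced : Σ OStr λ C → Induced C G (_≺_ o) S
  induced = (sub , sub-order) , record
    { f     = f
    ; inj   = λ _ _ → f-injective
    ; image = image
    ; arc   = λ _ _ → refl
    ; ord   = λ _ _ → mk⇔ id id
    }

lemma3p5 : (Ω : TypeOrder) (𝒪 : OStr → Set) → Admissible Ω 𝒪 →
           ∀ (A : D1) (o : Order A) → 𝒪 (A , o) →
           ∀ (a b : Fin (n A)) → circ A a b → _≺_ o b a
lemma3p5 Ω 𝒪 adm A o oA a b b∈a° =
  let Cb , Cb-ind = induced A o (scl? A b)
      Ca , Ca-ind = induced A o (scl? A a)
      Cb⊲Ca = TypeOrder.size Ω (Induced-scl⇒IsCE Cb-ind) (Induced-scl⇒IsCE Ca-ind)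
                (Induced-size-< Cb-ind Ca-ind (proj₁ b∈a° ◅◅_) ε (circ⇒¬scl A b∈a°))
  in Admissible.cond3 adm A o oA b a tt tt (inj₁ (Cb , Ca , Cb-ind , Ca-ind , Cb⊲Ca))
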